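{- Let $l,m,l',m'\ge 1$, let $u$ be an $(l,m)$-bounded $0$-$1$-string and $w$ an $(l',m')$-bounded $0$-$1$-string with $|u|=|w|$. Then (a) $\overline{u}$ is $(l,m)$-bounded; (b) $u\wedge w$ and $u\vee w$ are $(5(l+l'),mm')$-bounded.
   Context: For $0$-$1$-strings $u,w$ of equal length, $\overline u$ denotes the bitwise complement of $u$, and $u\wedge w$, $u\vee w$ the bitwise AND and bitwise OR. A string $w$ is $(l,m)$-bounded if $w\in u_1^*u_2^*\cdots u_l^*$ for some strings $u_1,\dots,u_l$ with $|u_i|\le m$ for every $i$. -}

module Defs where

open import Data.Bool using (Bool; not; _∧_; _∨_)
open import Data.Nat using (ℕ; _≤_)
open import Data.List using (List; []; _∷_; _++_; map; zipWith; length; concat; replicate)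
open import Data.Vec using (Vec)
open import Data.Vec.Relation.Unary.All using (All)
open import Data.Product using (Σ; _×_; ∃)
open import Relation.Binary.PropositionalEquality using (_≡_)

-- 0-1-strings: 0 = false, 1 = true
BitString : Set
BitString = List Bool

pow : BitString → ℕ → BitString
pow u k = concat (replicate k u)

_∈*_ : BitString → BitString → Set
w ∈* u = ∃ λ k → w ≡ pow u k

InStars : BitString → List BitString → Set
InStars w [] = w ≡ []
InStars w (u ∷ us) = Σ BitString λ x → Σ BitString λ y →
  (w ≡ x ++ y) × (x ∈* u) × InStars y us

Bounded : ℕ → ℕ → BitString → Set
Bounded l m w = Σ (Vec BitString l) λ us →
  All (λ u → length u ≤ m) us × InStars w (Data.Vec.toList us)

compl : BitString → BitString
compl = map not

bitAnd : BitString → BitString → BitString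
bitAnd = zipWith _∧_

bitOr : BitString → BitString → BitString
bitOr = zipWith _∨_

-- Cut u and w at the union of their block boundaries: this gives at most l + l′ pieces,
-- and on each piece u and w are factors of powers vᵏ and v′ᵏ′ with |v| ≤ m and |v′| ≤ m′.
-- A factor of a power is a prefix of a power of a rotation, and zipping a prefix of a
-- power of v with one of v′ gives a prefix of a power of the zip of v^|v′| and v′^|v|,
-- a word of length |v||v′| ≤ mm′. Finally a prefix of Vᴷ has the form Vʲ p with |p| ≤ |V|,
-- so every piece costs two stars and the result is even (2(l + l′), mm′)-bounded.
module Submission where

open import Defs
open import Data.Bool using (Bool; not; _∧_; _∨_)
open import Data.Nat using (ℕ; zero; suc; pred; _≤_; _*_; _+_; z≤n; s≤s; _≤′_; ≤′-refl; ≤′-step)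
open import Data.Nat.Properties
  using (+-suc; *-suc; *-comm; +-cancelˡ-≡; ≤-total; ≤-trans; ≤-reflexive; m≤m+n; m≤n+m;
         m≤n*m; *-mono-≤; *-monoʳ-≤; m≤n⇒∃[o]m+o≡n; m⊓n≤n; ≤⇒≤′)
open import Data.List using (List; []; _∷_; _++_; map; zipWith; length)
open import Data.List.Properties
  using (∷-injective; ++-assoc; ++-identityʳ; ++-conicalˡ; ++-conicalʳ; length-++;
         length-++-comm; length-++-≤ˡ; length-map; length-zipWith; map-++; zipWith-zeroʳ)
open import Data.Vec using (Vec; []; _∷_; toList)
import Data.Vec as Vec
open import Data.Vec.Properties using (toList-map)
open import Data.Vec.Relation.Unary.All using (All; []; _∷_)
import Data.Vec.Relation.Unary.All as All
open import Data.Vec.Relation.Unary.All.Properties using (map⁺)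
open import Data.Product using (Σ; ∃; _×_; _,_)
open import Data.Sum using (_⊎_; inj₁; inj₂)
open import Data.Empty using (⊥-elim)
open import Relation.Binary.PropositionalEquality
  using (_≡_; _≢_; refl; sym; trans; cong; cong₂; subst; subst₂; module ≡-Reasoning)

open ≡-Reasoning

++-equidivisible : (a b c d : BitString) → a ++ b ≡ c ++ d →
  (∃ λ t → c ≡ a ++ t × b ≡ t ++ d) ⊎ (∃ λ t → a ≡ c ++ t × d ≡ t ++ b)
++-equidivisible []      b c       d e = inj₁ (c , refl , e)
++-equidivisible (x ∷ a) b []      d e = inj₂ (x ∷ a , refl , sym e)
++-equidivisible (x ∷ a) b (y ∷ c) d e with ∷-injective e
... | refl , e′ with ++-equidivisible a b c d e′
... | inj₁ (t , c≡a++t , b≡t++d) = inj₁ (t , cong (x ∷_) c≡a++t , b≡t++d)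
... | inj₂ (t , a≡c++t , d≡t++b) = inj₂ (t , cong (x ∷_) a≡c++t , d≡t++b)

++-split-at : (x : BitString) (i : ℕ) → i ≤ length x →
  ∃ λ a → ∃ λ b → x ≡ a ++ b × length a ≡ i
++-split-at x       zero    _       = [] , x , refl , refl
++-split-at (c ∷ x) (suc i) (s≤s i≤|x|) with ++-split-at x i i≤|x|
... | a , b , refl , refl = c ∷ a , b , refl , refl

length-++-cancelˡ : (a b c d : BitString) → length (a ++ b) ≡ length (c ++ d) →
  length a ≡ length c → length b ≡ length d
length-++-cancelˡ a b c d e |a|≡|c| = +-cancelˡ-≡ (length a) _ _ (begin
  length a + length b  ≡⟨ sym (length-++ a) ⟩
  length (a ++ b)      ≡⟨ e ⟩
  length (c ++ d)      ≡⟨ length-++ c ⟩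
  length c + length d  ≡⟨ cong (_+ length d) (sym |a|≡|c|) ⟩
  length a + length d  ∎)

module _ (f : Bool → Bool → Bool) where

  zipWith-++ : (a b c d : BitString) → length a ≡ length c →
    zipWith f (a ++ b) (c ++ d) ≡ zipWith f a c ++ zipWith f b d
  zipWith-++ []      b []      d _ = refl
  zipWith-++ (x ∷ a) b (y ∷ c) d e = cong (f x y ∷_) (zipWith-++ a b c d (cong pred e))

  zipWith-pow : (a c : BitString) → length a ≡ length c → (k : ℕ) →
    zipWith f (pow a k) (pow c k) ≡ pow (zipWith f a c) k
  zipWith-pow a c e zero    = refl
  zipWith-pow a c e (suc k) =
    trans (zipWith-++ a (pow a k) c (pow c k) e) (cong (zipWith f a c ++_) (zipWith-pow a c e k))

  zip-prefixes-pow : (x y : BitString) {r r′ A B : BitString} (K : ℕ) →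
    x ++ r ≡ pow A K → y ++ r′ ≡ pow B K → length x ≡ length y → length A ≡ length B →
    zipWith f x y ++ zipWith f r r′ ≡ pow (zipWith f A B) K
  zip-prefixes-pow x y {r} {r′} {A} {B} K e e′ |x|≡|y| |A|≡|B| = begin
    zipWith f x y ++ zipWith f r r′  ≡⟨ sym (zipWith-++ x r y r′ |x|≡|y|) ⟩
    zipWith f (x ++ r) (y ++ r′)     ≡⟨ cong₂ (zipWith f) e e′ ⟩
    zipWith f (pow A K) (pow B K)    ≡⟨ zipWith-pow A B |A|≡|B| K ⟩
    pow (zipWith f A B) K            ∎

pow-+ : (v : BitString) (j k : ℕ) → pow v (j + k) ≡ pow v j ++ pow v k
pow-+ v zero    k = refl
pow-+ v (suc j) k = trans (cong (v ++_) (pow-+ v j k)) (sym (++-assoc v (pow v j) (pow v k)))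

pow-* : (v : BitString) (j k : ℕ) → pow v (j * k) ≡ pow (pow v j) k
pow-* v j zero    = cong (pow v) (*-comm j 0)
pow-* v j (suc k) = begin
  pow v (j * suc k)          ≡⟨ cong (pow v) (*-suc j k) ⟩
  pow v (j + j * k)          ≡⟨ pow-+ v j (j * k) ⟩
  pow v j ++ pow v (j * k)   ≡⟨ cong (pow v j ++_) (pow-* v j k) ⟩
  pow (pow v j) (suc k)      ∎

length-pow : (v : BitString) (k : ℕ) → length (pow v k) ≡ k * length v
length-pow v zero    = refl
length-pow v (suc k) = trans (length-++ v) (cong (length v +_) (length-pow v k))

pow-[] : (k : ℕ) → pow [] k ≡ []
pow-[] zero    = refl
pow-[] (suc k) = pow-[] k

∷≢pow-[] : ∀ {b x} k → b ∷ x ≢ pow [] k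
∷≢pow-[] k e with trans e (pow-[] k)
... | ()

map-pow : (g : Bool → Bool) (u : BitString) (k : ℕ) → map g (pow u k) ≡ pow (map g u) k
map-pow g u zero    = refl
map-pow g u (suc k) = trans (map-++ g u (pow u k)) (cong (map g u ++_) (map-pow g u k))

rotate-pow : (s t : BitString) (k : ℕ) → pow (s ++ t) k ++ s ≡ s ++ pow (t ++ s) k
rotate-pow s t zero    = sym (++-identityʳ s)
rotate-pow s t (suc k) = begin
  ((s ++ t) ++ pow (s ++ t) k) ++ s  ≡⟨ ++-assoc (s ++ t) (pow (s ++ t) k) s ⟩
  (s ++ t) ++ pow (s ++ t) k ++ s    ≡⟨ cong ((s ++ t) ++_) (rotate-pow s t k) ⟩
  (s ++ t) ++ s ++ pow (t ++ s) k    ≡⟨ ++-assoc s t (s ++ pow (t ++ s) k) ⟩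
  s ++ t ++ s ++ pow (t ++ s) k      ≡⟨ cong (s ++_) (sym (++-assoc t s (pow (t ++ s) k))) ⟩
  s ++ pow (t ++ s) (suc k)          ∎

prefix-pow-≤ : ∀ {x r v k k′} → k ≤ k′ → x ++ r ≡ pow v k → ∃ λ r′ → x ++ r′ ≡ pow v k′
prefix-pow-≤ {x} {r} {v} {k} k≤k′ e with m≤n⇒∃[o]m+o≡n k≤k′
... | d , refl = r ++ pow v d , (begin
  x ++ r ++ pow v d    ≡⟨ sym (++-assoc x r (pow v d)) ⟩
  (x ++ r) ++ pow v d  ≡⟨ cong (_++ pow v d) e ⟩
  pow v k ++ pow v d   ≡⟨ sym (pow-+ v k d) ⟩
  pow v (k + d)        ∎)

prefix-pow-pow : ∀ {r k} (x v : BitString) (j K : ℕ) → x ++ r ≡ pow v k → k ≤ j * K →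
  ∃ λ r′ → x ++ r′ ≡ pow (pow v j) K
prefix-pow-pow x v j K e k≤jK with prefix-pow-≤ k≤jK e
... | r′ , e′ = r′ , trans e′ (pow-* v j K)

prefix-pow-split : (v : BitString) (k : ℕ) (x r : BitString) → x ++ r ≡ pow v k →
  ∃ λ j → ∃ λ p → x ≡ pow v j ++ p × length p ≤ length v
prefix-pow-split v zero x r e with ++-conicalˡ x r e
... | refl = zero , [] , refl , z≤n
prefix-pow-split v (suc k) x r e with ++-equidivisible x r v (pow v k) e
... | inj₁ (t , refl , _) = zero , x , refl , length-++-≤ˡ x
... | inj₂ (t , refl , e′) with prefix-pow-split v k t r (sym e′)
...   | j , p , refl , |p| = suc j , p , sym (++-assoc v (pow v j) p) , |p|

Periodic : ℕ → BitString → Set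
Periodic n x = Σ BitString λ v → Σ ℕ λ k → Σ BitString λ r → length v ≤ n × x ++ r ≡ pow v k

[]-periodic : ∀ {n} → Periodic n []
[]-periodic = [] , zero , [] , z≤n , refl

pow-periodic : ∀ {n v} k → length v ≤ n → Periodic n (pow v k)
pow-periodic {v = v} k |v| = v , k , [] , |v| , ++-identityʳ (pow v k)

infix-periodic : ∀ {n} (v : BitString) (k : ℕ) (s x r : BitString) → length v ≤ n →
  s ++ x ++ r ≡ pow v k → Periodic n x
infix-periodic v zero s x r _ e =
  subst (Periodic _) (sym (++-conicalˡ x r (++-conicalʳ s (x ++ r) e))) []-periodic
infix-periodic v (suc k) s x r |v| e with ++-equidivisible s (x ++ r) v (pow v k) e
... | inj₂ (t , refl , e′) = infix-periodic v k t x r |v| (sym e′)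
... | inj₁ (t , refl , e′) =
  -- x starts inside the first copy of v = s ++ t, so it is a prefix of a power of t ++ s
  t ++ s , suc k , r ++ s , subst (_≤ _) (length-++-comm s t) |v| , (begin
    x ++ r ++ s                 ≡⟨ sym (++-assoc x r s) ⟩
    (x ++ r) ++ s               ≡⟨ cong (_++ s) e′ ⟩
    (t ++ pow (s ++ t) k) ++ s  ≡⟨ ++-assoc t (pow (s ++ t) k) s ⟩
    t ++ pow (s ++ t) k ++ s    ≡⟨ cong (t ++_) (rotate-pow s t k) ⟩
    t ++ s ++ pow (t ++ s) k    ≡⟨ sym (++-assoc t s (pow (t ++ s) k)) ⟩
    pow (t ++ s) (suc k)        ∎)

periodic-prefix : ∀ {n} (a b : BitString) → Periodic n (a ++ b) → Periodic n a
periodic-prefix a b (v , k , r , |v| , e) = v , k , b ++ r , |v| , trans (sym (++-assoc a b r)) e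

periodic-suffix : ∀ {n} (a b : BitString) → Periodic n (a ++ b) → Periodic n b
periodic-suffix a b (v , k , r , |v| , e) = infix-periodic v k a b r |v| (trans (sym (++-assoc a b r)) e)

zipWith-periodic : (f : Bool → Bool → Bool) {n n′ : ℕ} (x y : BitString) →
  Periodic n x → Periodic n′ y → length x ≡ length y → Periodic (n * n′) (zipWith f x y)
zipWith-periodic f [] y _ _ _ = []-periodic
zipWith-periodic f (b ∷ x) (b′ ∷ y) ([] , k , _ , _ , e) _ _ = ⊥-elim (∷≢pow-[] k e)
zipWith-periodic f (b ∷ x) (b′ ∷ y) _ ([] , k′ , _ , _ , e′) _ = ⊥-elim (∷≢pow-[] k′ e′)
zipWith-periodic f {n} {n′} x@(_ ∷ _) y@(_ ∷ _)
  (v@(_ ∷ _) , k , r , |v| , e) (v′@(_ ∷ _) , k′ , r′ , |v′| , e′) |x|≡|y| =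
  -- A and B both have length |v||v′|, and as v, v′ ≠ [] the exponent k + k′ covers x and y
  let (R , xR≡Aᴷ)  = prefix-pow-pow x v L′ K e (≤-trans (m≤m+n k k′) (m≤n*m K L′))
      (R′ , yR′≡Bᴷ) = prefix-pow-pow y v′ L K e′ (≤-trans (m≤n+m k′ k) (m≤n*m K L))
  in zipWith f A B , K , zipWith f R R′ , |AB| , zip-prefixes-pow f x y K xR≡Aᴷ yR′≡Bᴷ |x|≡|y| |A|≡|B|
  where
  L  = length v
  L′ = length v′
  K  = k + k′
  A  = pow v L′
  B  = pow v′ L
  |A|≡|B| : length A ≡ length B
  |A|≡|B| = trans (length-pow v L′) (trans (*-comm L′ L) (sym (length-pow v′ L)))
  |AB| : length (zipWith f A B) ≤ n * n′
  |AB| = ≤-trans (subst (_≤ length B) (sym (length-zipWith f A B)) (m⊓n≤n (length A) (length B)))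
                 (subst (_≤ n * n′) (sym (length-pow v′ L)) (*-mono-≤ |v| |v′|))

InStars-map : (g : Bool → Bool) {w : BitString} (us : List BitString) →
  InStars w us → InStars (map g w) (map (map g) us)
InStars-map g []       refl = refl
InStars-map g (u ∷ us) (x , y , refl , (k , refl) , st) =
  map g (pow u k) , map g y , map-++ g (pow u k) y , (k , map-pow g u k) , InStars-map g us st

Bounded-map : (g : Bool → Bool) {l m : ℕ} {w : BitString} → Bounded l m w → Bounded l m (map g w)
Bounded-map g {m = m} (us , |us| , st) =
  Vec.map (map g) us ,
  map⁺ (All.map (λ {u} |u| → subst (_≤ m) (sym (length-map g u)) |u|) |us|) ,
  subst (InStars _) (sym (toList-map (map g) us)) (InStars-map g (toList us) st)

Bounded-++ : ∀ {a b n x y} → Bounded a n x → Bounded b n y → Bounded (a + b) n (x ++ y)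
Bounded-++ ([] , [] , refl) By = By
Bounded-++ {y = y} ((u ∷ us) , (|u| ∷ |us|) , (x₁ , x₂ , refl , x₁∈u* , st)) By
  with Bounded-++ (us , |us| , st) By
... | vs , |vs| , st′ = (u ∷ vs) , (|u| ∷ |vs|) , (x₁ , x₂ ++ y , ++-assoc x₁ x₂ y , x₁∈u* , st′)

Bounded-suc : ∀ {l n x} → Bounded l n x → Bounded (suc l) n x
Bounded-suc {x = x} (us , |us| , st) = ([] ∷ us) , (z≤n ∷ |us|) , ([] , x , refl , (zero , refl) , st)

Bounded-mono : ∀ {l l′ n x} → l ≤ l′ → Bounded l n x → Bounded l′ n x
Bounded-mono l≤l′ = go (≤⇒≤′ l≤l′)
  where
  go : ∀ {l l′ n x} → l ≤′ l′ → Bounded l n x → Bounded l′ n x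
  go ≤′-refl       Bx = Bx
  go (≤′-step l≤l′) Bx = Bounded-suc (go l≤l′ Bx)

periodic⇒bounded : ∀ {n x} → Periodic n x → Bounded 2 n x
periodic⇒bounded {x = x} (v , k , r , |v| , e) with prefix-pow-split v k x r e
... | j , p , refl , |p| =
  (v ∷ p ∷ []) , (|v| ∷ ≤-trans |p| |v| ∷ []) ,
  (pow v j , p , refl , (j , refl) , (p , [] , sym (++-identityʳ p) , (1 , sym (++-identityʳ p)) , refl))

data Blocks (n : ℕ) : ℕ → BitString → Set where
  []  : Blocks n 0 []
  _∷_ : ∀ {c x y} → Periodic n x → Blocks n c y → Blocks n (suc c) (x ++ y)

[]-blocks : ∀ {n} c → Blocks n c []
[]-blocks zero    = []
[]-blocks (suc c) = []-periodic ∷ []-blocks c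

stars⇒blocks : ∀ {l m w} (us : Vec BitString l) → All (λ u → length u ≤ m) us →
  InStars w (toList us) → Blocks m l w
stars⇒blocks []       []           refl = []
stars⇒blocks (u ∷ us) (|u| ∷ |us|) (_ , _ , refl , (k , refl) , st) =
  pow-periodic k |u| ∷ stars⇒blocks us |us| st

bounded⇒blocks : ∀ {l m w} → Bounded l m w → Blocks m l w
bounded⇒blocks (us , |us| , st) = stars⇒blocks us |us| st

blocks⇒bounded : ∀ {n c x} → Blocks n c x → Bounded (c * 2) n x
blocks⇒bounded []        = [] , [] , refl
blocks⇒bounded (px ∷ bx) = Bounded-++ (periodic⇒bounded px) (blocks⇒bounded bx)

-- The block counts are explicit arguments so that termination is visible: (c , c′)
-- decreases lexicographically, although the block lists themselves do not.
zipWith-blocks : (f : Bool → Bool → Bool) {n n′ : ℕ} (c c′ : ℕ) {u w : BitString} →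
  Blocks n c u → Blocks n′ c′ w → length u ≡ length w → Blocks (n * n′) (c + c′) (zipWith f u w)
zipWith-blocks f zero    c′ [] _ _ = []-blocks c′
zipWith-blocks f (suc c) zero {u} _ [] _ =
  subst (Blocks _ (suc c + 0)) (sym (zipWith-zeroʳ f u)) ([]-blocks (suc c + 0))
zipWith-blocks f (suc c) (suc c′) (_∷_ {x = x} {y} px by) (_∷_ {x = x′} {y′} px′ by′) e
  with ≤-total (length x) (length x′)
... | inj₁ |x|≤|x′| with ++-split-at x′ (length x) |x|≤|x′|
...   | a , b , refl , |a|≡|x| =
  subst (Blocks _ _) (sym zip-eq)
    (zipWith-periodic f x a px (periodic-prefix a b px′) (sym |a|≡|x|)
      ∷ zipWith-blocks f c (suc c′) by (periodic-suffix a b px′ ∷ by′) |y|≡|by′|)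
  where
  zip-eq : zipWith f (x ++ y) ((a ++ b) ++ y′) ≡ zipWith f x a ++ zipWith f y (b ++ y′)
  zip-eq = trans (cong (zipWith f (x ++ y)) (++-assoc a b y′)) (zipWith-++ f x y a (b ++ y′) (sym |a|≡|x|))
  |y|≡|by′| : length y ≡ length (b ++ y′)
  |y|≡|by′| = length-++-cancelˡ x y a (b ++ y′) (trans e (cong length (++-assoc a b y′))) (sym |a|≡|x|)
zipWith-blocks f (suc c) (suc c′) (_∷_ {x = x} {y} px by) (_∷_ {x = x′} {y′} px′ by′) e
  | inj₂ |x′|≤|x| with ++-split-at x (length x′) |x′|≤|x|
...   | a , b , refl , |a|≡|x′| =
  subst₂ (Blocks _) (sym (+-suc (suc c) c′)) (sym zip-eq)
    (zipWith-periodic f a x′ (periodic-prefix a b px) px′ |a|≡|x′|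
      ∷ zipWith-blocks f (suc c) c′ (periodic-suffix a b px ∷ by) by′ |by|≡|y′|)
  where
  zip-eq : zipWith f ((a ++ b) ++ y) (x′ ++ y′) ≡ zipWith f a x′ ++ zipWith f (b ++ y) y′
  zip-eq = trans (cong (λ z → zipWith f z (x′ ++ y′)) (++-assoc a b y)) (zipWith-++ f a (b ++ y) x′ y′ |a|≡|x′|)
  |by|≡|y′| : length (b ++ y) ≡ length y′
  |by|≡|y′| = length-++-cancelˡ a (b ++ y) x′ y′ (trans (cong length (sym (++-assoc a b y))) e) |a|≡|x′|

Bounded-zipWith : (f : Bool → Bool → Bool) {l m l′ m′ : ℕ} {u w : BitString} →
  Bounded l m u → Bounded l′ m′ w → length u ≡ length w →
  Bounded (5 * (l + l′)) (m * m′) (zipWith f u w)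
Bounded-zipWith f {l} {l′ = l′} Bu Bw e =
  Bounded-mono (≤-trans (*-monoʳ-≤ (l + l′) 2≤5) (≤-reflexive (*-comm (l + l′) 5)))
    (blocks⇒bounded (zipWith-blocks f l l′ (bounded⇒blocks Bu) (bounded⇒blocks Bw) e))
  where
  2≤5 : 2 ≤ 5
  2≤5 = s≤s (s≤s z≤n)

lemma24 : (l m l′ m′ : ℕ) → 1 ≤ l → 1 ≤ m → 1 ≤ l′ → 1 ≤ m′ →
    (u w : BitString) → Bounded l m u → Bounded l′ m′ w → length u ≡ length w →
    Bounded l m (compl u)
      × Bounded (5 * (l + l′)) (m * m′) (bitAnd u w)
      × Bounded (5 * (l + l′)) (m * m′) (bitOr u w)
lemma24 l m l′ m′ _ _ _ _ u w Bu Bw e =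
  Bounded-map not Bu , Bounded-zipWith _∧_ Bu Bw e , Bounded-zipWith _∨_ Bu Bw e
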